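{- Let $\mathcal{F}=\langle W,R,\{S_x\}_{x\in W}\rangle$ be a Veltman frame, $f$ an ultrafilter on $W$, and $l$ a proper filter on $W$. Let $B_f$ be the set of all $A\subseteq W$ for which there is a finite (possibly empty) family $S_1,\dots,S_n\in l$ with $S^{ -1}(\overline{A},\overline{S_1}\cup\dots\cup\overline{S_n})\in f$. Then for every $C\in B_f$, also $\widehat{R^{ -1}}(C)\in B_f$.
   Context: A Veltman frame is $\langle W,R,\{S_w\}\rangle$ where: - $W$ is nonempty. - $R$ is transitive and conversely well-founded. - Each $S_w$ is a reflexive transitive relation on $R[w]=\{v:wRv\}$ containing $R\cap R[w]^2$. For $X,Y\subseteq W$: - $\overline{Y}=W\setminus Y$. - $\widehat{R^{ -1}}(Y)=\{x:\forall y(xRy\to y\in Y)\}$. - $S^{ -1}(X,Y)=\{w:\forall x\in X(wRx\to\exists y\in Y\,xS_wy)\}$. A proper filter is a filter not containing $\emptyset$. -}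

module Defs where

open import Level using (0ℓ)
open import Data.Unit using (⊤)
open import Data.Empty using (⊥)
open import Data.Product using (_×_; ∃)
open import Data.Sum using (_⊎_)
open import Data.Nat using (ℕ)
open import Data.Fin using (Fin)
open import Relation.Nullary using (¬_)
open import Relation.Binary using (Rel; Transitive)
open import Function using (flip)
open import Induction.WellFounded using (WellFounded)

Subset : Set → Set₁
Subset W = W → Set

Family : Set → Set₂
Family W = Subset W → Set₁

module _ {W : Set} where
  _⊆_ : Subset W → Subset W → Set
  A ⊆ B = ∀ {x} → A x → B x

  _∩_ : Subset W → Subset W → Subset W
  (A ∩ B) x = A x × B x

  full : Subset W
  full _ = ⊤

  empty : Subset W
  empty _ = ⊥

  ∁ : Subset W → Subset W
  ∁ A x = ¬ A x

  -- \overline{S₁} ∪ … ∪ \overline{Sₙ}  (empty union = ∅)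
  -- a finite family S₁,…,Sₙ is a map Fin n → Subset W
  ⋃∁ : ∀ {n} → (Fin n → Subset W) → Subset W
  ⋃∁ Ss x = ∃ λ i → ¬ Ss i x

record IsFilter {W : Set} (F : Family W) : Set₂ where
  field
    has-full : F full
    upward   : ∀ {A B} → A ⊆ B → F A → F B
    meet     : ∀ {A B} → F A → F B → F (A ∩ B)

record IsProperFilter {W : Set} (F : Family W) : Set₂ where
  field
    isFilter : IsFilter F
    proper   : ¬ F empty

record IsUltrafilter {W : Set} (F : Family W) : Set₂ where
  field
    isProperFilter : IsProperFilter F
    ultra          : ∀ A → F A ⊎ F (∁ A)

record VeltmanFrame : Set₁ where
  field
    W        : Set
    R        : Rel W 0ℓ
    S        : W → Rel W 0ℓ
    inhabited : W
    R-trans  : Transitive R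
    -- conversely well-founded: no infinite chain x₀ R x₁ R x₂ R …
    R-cwf    : WellFounded (flip R)
    S-dom    : ∀ {w x y} → S w x y → R w x × R w y
    S-refl   : ∀ {w x} → R w x → S w x x
    S-trans  : ∀ {w x y z} → S w x y → S w y z → S w x z
    R⊆S      : ∀ {w x y} → R w x → R w y → R x y → S w x y

module Ops (F : VeltmanFrame) where
  open VeltmanFrame F

  -- \widehat{R^{-1}}(Y) = {x : ∀ y (x R y → y ∈ Y)}
  □R : Subset W → Subset W
  □R Y x = ∀ y → R x y → Y y

  S⁻¹ : Subset W → Subset W → Subset W
  S⁻¹ X Y w = ∀ x → X x → R w x → ∃ λ y → Y y × S w x y

  B : (f l : Family W) → Family W
  B f l A = ∃ λ (n : ℕ) → ∃ λ (Ss : Fin n → Subset W) →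
              (∀ i → l (Ss i)) × f (S⁻¹ (∁ A) (⋃∁ Ss))

{-# OPTIONS --safe #-}
module Submission where

-- A world x outside □R C sees some y ∉ C. For w ∈ S⁻¹(∁ C, Y) with w R x we get
-- w R y, hence y S_w z for some z ∈ Y, and x S_w y because R ∩ R[w]² ⊆ S_w; so
-- x S_w z by transitivity. Thus S⁻¹(∁ C, Y) ⊆ S⁻¹(∁ (□R C), Y) for every Y, and
-- the family S₁,…,Sₙ witnessing C ∈ B_f also witnesses □R C ∈ B_f.

open import Defs
open import Axiom.ExcludedMiddle using (ExcludedMiddle)
open import Axiom.DoubleNegationElimination using (DoubleNegationElimination; em⇒dne)
open import Level using (0ℓ)
open import Data.Product using (_×_; _,_; ∃)
open import Function using (_∘_)

module _ (F : VeltmanFrame) where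
  open VeltmanFrame F
  open Ops F

  ◇R : Subset W → Subset W
  ◇R X x = ∃ λ y → R x y × X y

  ∁□R⊆◇R∁ : ExcludedMiddle 0ℓ → ∀ C → ∁ (□R C) ⊆ ◇R (∁ C)
  ∁□R⊆◇R∁ em C ¬□C = dne λ ¬◇∁C → ¬□C λ y xRy → dne λ ¬Cy → ¬◇∁C (y , xRy , ¬Cy)
    where
    dne : DoubleNegationElimination 0ℓ
    dne = em⇒dne em

  S⁻¹-antitoneˡ : ∀ {X X′} Y → X′ ⊆ X → S⁻¹ X Y ⊆ S⁻¹ X′ Y
  S⁻¹-antitoneˡ Y X′⊆X w∈S⁻¹ x x∈X′ = w∈S⁻¹ x (X′⊆X x∈X′)

  S⁻¹⊆S⁻¹-◇R : ∀ X Y → S⁻¹ X Y ⊆ S⁻¹ (◇R X) Y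
  S⁻¹⊆S⁻¹-◇R X Y w∈S⁻¹ x (y , xRy , y∈X) wRx =
    let wRy           = R-trans wRx xRy
        z , z∈Y , ySz = w∈S⁻¹ y y∈X wRy
    in  z , z∈Y , S-trans (R⊆S wRx wRy xRy) ySz

  S⁻¹-∁⊆S⁻¹-∁□R : ExcludedMiddle 0ℓ → ∀ C Y → S⁻¹ (∁ C) Y ⊆ S⁻¹ (∁ (□R C)) Y
  S⁻¹-∁⊆S⁻¹-∁□R em C Y = S⁻¹-antitoneˡ Y (∁□R⊆◇R∁ em C) ∘ S⁻¹⊆S⁻¹-◇R (∁ C) Y

lemma5p6 : ExcludedMiddle 0ℓ → (F : VeltmanFrame) → (f l : Family (VeltmanFrame.W F)) → IsUltrafilter f → IsProperFilter l → ∀ C → Ops.B F f l C → Ops.B F f l (Ops.□R F C)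
lemma5p6 em F f l uf _ C (n , Ss , Ss∈l , S⁻¹∈f) =
  n , Ss , Ss∈l , upward (S⁻¹-∁⊆S⁻¹-∁□R F em C (⋃∁ Ss)) S⁻¹∈f
  where open IsFilter (IsProperFilter.isFilter (IsUltrafilter.isProperFilter uf))
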